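{- Let $T$ be a threshold graph which is not complete, with vertex connectivity $\kappa$, clique number $d$ and $b$--vector $(b_1,\ldots,b_d)$. Then $$b_{i+1}<\sum_{Y\subseteq V(T),\ |Y|=i}\bigl(W(T-Y)-1\bigr)$$ for every $\kappa+1\le i\le d-1$.
   Context: All graphs are finite and simple. A threshold graph is a graph obtainable from a one-vertex graph by repeatedly adding either an isolated vertex or a vertex adjacent to all existing vertices. A clique is a set of vertices inducing a complete subgraph; the clique number $d$ is the largest size of a clique. If $c_i$ is the number of cliques with $i$ vertices, the $b$--vector $(b_1,\ldots,b_d)$ is defined by $\sum_{i=1}^d b_i(x+1)^{i-1}=\sum_{i=1}^d c_ix^{i-1}$. A vertex-cut is a set of vertices whose removal disconnects the graph; the vertex connectivity $\kappa$ is the minimum cardinality of a vertex-cut. For $Y\subseteq V(T)$, $W(T-Y)$ is the number of connected components of $T-Y$. -}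

module Defs where

open import Data.Bool using (Bool; true; false)
open import Data.Nat using (ℕ; zero; suc; _≤_; _≥_) renaming (_≟_ to _≟ℕ_)
open import Data.Integer using (ℤ; +_; _+_; _*_; _^_; 0ℤ; 1ℤ)
open import Data.Fin using (Fin; punchIn; _≟_)
open import Data.Fin.Properties using (all?)
open import Data.Fin.Subset using (Subset; _∈_; _∉_; ∣_∣)
open import Data.Fin.Subset.Properties using (_∈?_)
open import Data.List using (List; []; _∷_; map; filter; length; sum; _++_)
open import Data.Vec using ([]; _∷_)
open import Data.Product using (Σ; ∃; _×_; _,_)
open import Data.Sum using (_⊎_)
open import Relation.Nullary using (¬_; Dec)
open import Relation.Nullary.Decidable using (¬?; _→-dec_)
open import Relation.Binary.PropositionalEquality using (_≡_; _≢_)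
open import Relation.Binary.Construct.Closure.ReflexiveTransitive using (Star)
open import Function.Bundles using (_⇔_)

record Graph (n : ℕ) : Set where
  field
    adj    : Fin n → Fin n → Bool
    sym    : ∀ u v → adj u v ≡ adj v u
    irrefl : ∀ v → adj v v ≡ false
open Graph public

Adj : ∀ {n} → Graph n → Fin n → Fin n → Set
Adj G u v = adj G u v ≡ true

delete : ∀ {n} → Graph (suc n) → Fin (suc n) → Graph n
delete G v = record
  { adj    = λ a b → adj G (punchIn v a) (punchIn v b)
  ; sym    = λ a b → sym G (punchIn v a) (punchIn v b)
  ; irrefl = λ a → irrefl G (punchIn v a) }

Isolated : ∀ {n} → Graph n → Fin n → Set
Isolated G v = ∀ u → ¬ Adj G v u

Dominating : ∀ {n} → Graph n → Fin n → Set
Dominating G v = ∀ u → u ≢ v → Adj G v u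

-- Threshold graphs: obtainable from a one-vertex graph by repeatedly
-- adding an isolated or a dominating vertex.  Read backwards: a graph is
-- threshold iff it has one vertex, or it has an isolated or dominating
-- vertex v (the last added one) such that G - v is threshold.
data IsThreshold : ∀ {n} → Graph n → Set where
  single : (G : Graph 1) → IsThreshold G
  step   : ∀ {n} (G : Graph (suc (suc n))) (v : Fin (suc (suc n))) →
           Isolated G v ⊎ Dominating G v →
           IsThreshold (delete G v) → IsThreshold G

IsComplete : ∀ {n} → Graph n → Set
IsComplete G = ∀ u v → u ≢ v → Adj G u v

IsClique : ∀ {n} → Graph n → Subset n → Set
IsClique G Y = ∀ u v → u ∈ Y → v ∈ Y → u ≢ v → Adj G u v

isClique? : ∀ {n} (G : Graph n) (Y : Subset n) → Dec (IsClique G Y)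
isClique? G Y = all? λ u → all? λ v →
  (u ∈? Y) →-dec ((v ∈? Y) →-dec (¬? (u ≟ v) →-dec (Data.Bool._≟_ (adj G u v) true)))
  where import Data.Bool

allSubsets : ∀ n → List (Subset n)
allSubsets zero    = [] ∷ []
allSubsets (suc n) = map (true ∷_) (allSubsets n) ++ map (false ∷_) (allSubsets n)

subsetsOfSize : ∀ n → ℕ → List (Subset n)
subsetsOfSize n i = filter (λ Y → ∣ Y ∣ ≟ℕ i) (allSubsets n)

cliqueCount : ∀ {n} → Graph n → ℕ → ℕ
cliqueCount {n} G i = length (filter (isClique? G) (subsetsOfSize n i))

IsCliqueNumber : ∀ {n} → Graph n → ℕ → Set
IsCliqueNumber G d =
  (Σ _ λ Y → IsClique G Y × ∣ Y ∣ ≡ d) × (∀ Y → IsClique G Y → ∣ Y ∣ ≤ d)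

sum1to : ℕ → (ℕ → ℤ) → ℤ
sum1to zero    f = 0ℤ
sum1to (suc d) f = sum1to d f + f (suc d)

-- b is the b-vector (b_1,…,b_d) of G (with clique number d):
--   Σ_{i=1}^d b_i (x+1)^{i-1} = Σ_{i=1}^d c_i x^{i-1}  as polynomials,
-- i.e. for every integer x (a polynomial identity over ℤ).
IsBVector : ∀ {n} → Graph n → ℕ → (ℕ → ℤ) → Set
IsBVector G d b = ∀ (x : ℤ) →
  sum1to d (λ i → b i * (x + 1ℤ) ^ Data.Nat.pred i)
    ≡ sum1to d (λ i → + cliqueCount G i * x ^ Data.Nat.pred i)
  where import Data.Nat

EdgeAvoiding : ∀ {n} → Graph n → Subset n → Fin n → Fin n → Set
EdgeAvoiding G Y u v = u ∉ Y × v ∉ Y × Adj G u v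

Connected : ∀ {n} → Graph n → Subset n → Fin n → Fin n → Set
Connected G Y = Star (EdgeAvoiding G Y)

NumComponents : ∀ {n} → Graph n → Subset n → ℕ → Set
NumComponents {n} G Y k =
  Σ ((v : Fin n) → v ∉ Y → Fin k) λ f →
    (∀ (j : Fin k) → ∃ λ v → Σ (v ∉ Y) λ p → f v p ≡ j) ×
    (∀ u v (p : u ∉ Y) (q : v ∉ Y) → (f u p ≡ f v q) ⇔ Connected G Y u v)

IsVertexCut : ∀ {n} → Graph n → Subset n → Set
IsVertexCut G Y = ∃ λ u → ∃ λ v → u ∉ Y × v ∉ Y × ¬ Connected G Y u v

IsVertexConnectivity : ∀ {n} → Graph n → ℕ → Set
IsVertexConnectivity G κ =
  (Σ _ λ Y → IsVertexCut G Y × ∣ Y ∣ ≡ κ) × (∀ Y → IsVertexCut G Y → κ ≤ ∣ Y ∣)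

sumOverSize : ∀ n → ℕ → (Subset n → ℤ) → ℤ
sumOverSize n i f = Data.List.foldr _+_ 0ℤ (map f (subsetsOfSize n i))
  where import Data.List

-- Build T one vertex at a time. An isolated vertex adds one 1-clique; a dominating vertex
-- multiplies the clique polynomial by 1 + x. Hence along the construction b₁ grows by 1,
-- resp. b is shifted one place with b₁ = 1, so b is known explicitly (by uniqueness of the
-- expansion in the powers of x + 1 it equals the given b-vector). The same recursion bounds
-- Σ_{|Y|=i} W(T−Y): sets Y ∋ v contribute the corresponding sum for T − v, sets Y ∌ v
-- contribute at least one component each, and one more when v is isolated. This gives
-- b_{i+1} < Σ_{|Y|=i} W(T−Y) for 1 ≤ i < n. Above the connectivity the same holds for
-- W − 1: a dominating vertex lies in every vertex cut, so cut and i shrink together, and an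
-- isolated vertex reduces the claim to the previous bound for T − v.
module Submission where

open import Defs hiding (sym)
open import Data.Bool using (Bool; true; false; if_then_else_)
open import Data.Nat as ℕ using (ℕ; zero; suc; pred; z≤n; s≤s) renaming (_≟_ to _≟ℕ_)
import Data.Nat.Properties as ℕP
open import Data.Integer as ℤ using (ℤ; +_; _+_; _-_; -_; _*_; _^_; 0ℤ; 1ℤ; _≤_; _<_; +≤+)
import Data.Integer.Properties as ℤP
open import Algebra.Properties.CommutativeSemigroup ℤP.+-commutativeSemigroup using (interchange)
open import Algebra.Properties.AbelianGroup ℤP.+-0-abelianGroup using (inverseˡ-unique)
open import Data.Integer.Tactic.RingSolver using (solve-∀)
open import Data.Fin using (Fin; punchIn; punchOut; _≟_) renaming (zero to fz; suc to fs)
open import Data.Fin.Properties using (punchIn-injective; punchInᵢ≢i; punchIn-punchOut; injective⇒≤)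
open import Data.Fin.Subset using (Subset; _∈_; _∉_; ∣_∣; ⊥; ⊤)
open import Data.Fin.Subset.Properties
  using (drop-there; ∉⊥; ∈⊤; ∣⊥∣≡0; ∣p∣≤n; ∣p∣≡n⇒p≡⊤; Empty-unique; _∈?_)
open import Data.List using (List; []; _∷_; map; filter; length; _++_; foldr)
open import Data.Vec using ([]; _∷_; insertAt; removeAt)
open import Data.Vec.Properties using ([]=⇒lookup; lookup⇒[]=; insertAt-lookup; insertAt-punchIn; insertAt-removeAt)
open import Data.Product using (Σ; ∃; _×_; _,_; proj₁; proj₂)
open import Data.Sum using (inj₁; inj₂)
open import Relation.Nullary using (¬_; Dec; yes; no; does)
open import Relation.Nullary.Decidable using (does-⇔; dec-true; dec-false)
open import Relation.Binary.PropositionalEquality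
open import Relation.Binary.Construct.Closure.ReflexiveTransitive using (ε; _◅_; _◅◅_)
open import Data.Empty using (⊥-elim) renaming (⊥ to False)
open import Function using (_∘_)
open import Function.Bundles using (_⇔_; mk⇔; Equivalence)

-- Sums over the subsets of a given size

sumOver : ∀ {A : Set} → List A → (A → ℤ) → ℤ
sumOver xs f = foldr _+_ 0ℤ (map f xs)

module _ {A : Set} where

  sumOver-++ : ∀ (xs ys : List A) f → sumOver (xs ++ ys) f ≡ sumOver xs f + sumOver ys f
  sumOver-++ []       ys f = sym (ℤP.+-identityˡ _)
  sumOver-++ (x ∷ xs) ys f = trans (cong (λ s → f x + s) (sumOver-++ xs ys f)) (sym (ℤP.+-assoc (f x) _ _))

  sumOver-map : ∀ {B : Set} (g : A → B) (xs : List A) f → sumOver (map g xs) f ≡ sumOver xs (λ x → f (g x))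
  sumOver-map g []       f = refl
  sumOver-map g (x ∷ xs) f = cong (λ s → f (g x) + s) (sumOver-map g xs f)

  sumOver-mono : ∀ (xs : List A) {f g} → (∀ x → f x ≤ g x) → sumOver xs f ≤ sumOver xs g
  sumOver-mono []       f≤g = ℤP.≤-refl
  sumOver-mono (x ∷ xs) f≤g = ℤP.+-mono-≤ (f≤g x) (sumOver-mono xs f≤g)

  sumOver-cong : ∀ (xs : List A) {f g} → (∀ x → f x ≡ g x) → sumOver xs f ≡ sumOver xs g
  sumOver-cong []       f≡g = refl
  sumOver-cong (x ∷ xs) f≡g = cong₂ _+_ (f≡g x) (sumOver-cong xs f≡g)

  sumOver-+ : ∀ (xs : List A) f g → sumOver xs (λ x → f x + g x) ≡ sumOver xs f + sumOver xs g
  sumOver-+ []       f g = refl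
  sumOver-+ (x ∷ xs) f g = trans (cong (λ s → f x + g x + s) (sumOver-+ xs f g)) (interchange (f x) (g x) _ _)

  sumOver-0 : ∀ (xs : List A) → sumOver xs (λ _ → 0ℤ) ≡ 0ℤ
  sumOver-0 []       = refl
  sumOver-0 (x ∷ xs) = trans (ℤP.+-identityˡ _) (sumOver-0 xs)

sumOver-allSubsets-head : ∀ n (f : Subset (suc n) → ℤ) →
  sumOver (allSubsets (suc n)) f ≡
  sumOver (allSubsets n) (λ Y → f (true ∷ Y)) + sumOver (allSubsets n) (λ Y → f (false ∷ Y))
sumOver-allSubsets-head n f = trans (sumOver-++ (map (true ∷_) (allSubsets n)) _ f)
  (cong₂ _+_ (sumOver-map (true ∷_) (allSubsets n) f) (sumOver-map (false ∷_) (allSubsets n) f))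

sumOver-allSubsets-insertAt : ∀ n (v : Fin (suc n)) (f : Subset (suc n) → ℤ) →
  sumOver (allSubsets (suc n)) f ≡
  sumOver (allSubsets n) (λ Y → f (insertAt Y v true)) + sumOver (allSubsets n) (λ Y → f (insertAt Y v false))
sumOver-allSubsets-insertAt n       fz     f = sumOver-allSubsets-head n f
sumOver-allSubsets-insertAt (suc n) (fs v) f = begin
  sumOver (allSubsets (suc (suc n))) f
    ≡⟨ sumOver-allSubsets-head (suc n) f ⟩
  sumOver (allSubsets (suc n)) (λ Y → f (true ∷ Y)) + sumOver (allSubsets (suc n)) (λ Y → f (false ∷ Y))
    ≡⟨ cong₂ _+_ (sumOver-allSubsets-insertAt n v _) (sumOver-allSubsets-insertAt n v _) ⟩
  (S true true + S true false) + (S false true + S false false)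
    ≡⟨ interchange (S true true) (S true false) (S false true) (S false false) ⟩
  (S true true + S false true) + (S true false + S false false)
    ≡⟨ sym (cong₂ _+_ (sumOver-allSubsets-head n _) (sumOver-allSubsets-head n _)) ⟩
  sumOver (allSubsets (suc n)) (λ Y → f (insertAt Y (fs v) true)) +
  sumOver (allSubsets (suc n)) (λ Y → f (insertAt Y (fs v) false)) ∎
  where
  open ≡-Reasoning
  S : Bool → Bool → ℤ
  S a b = sumOver (allSubsets n) (λ Y → f (a ∷ insertAt Y v b))

sizeSum : ∀ n → ℕ → (Subset n → ℤ) → ℤ
sizeSum n i f = sumOver (allSubsets n) (λ Y → if does (∣ Y ∣ ≟ℕ i) then f Y else 0ℤ)

sumOverSize≡sizeSum : ∀ n i f → sumOverSize n i f ≡ sizeSum n i f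
sumOverSize≡sizeSum n i f = filtered (allSubsets n)
  where
  filtered : ∀ Ys → sumOver (filter (λ Y → ∣ Y ∣ ≟ℕ i) Ys) f ≡
                    sumOver Ys (λ Y → if does (∣ Y ∣ ≟ℕ i) then f Y else 0ℤ)
  filtered []       = refl
  filtered (Y ∷ Ys) with does (∣ Y ∣ ≟ℕ i)
  ... | true  = cong (λ s → f Y + s) (filtered Ys)
  ... | false = trans (filtered Ys) (sym (ℤP.+-identityˡ _))

private
  if-dec-≤ : ∀ {P : Set} (p? : Dec P) {x y} → (P → x ≤ y) →
    (if does p? then x else 0ℤ) ≤ (if does p? then y else 0ℤ)
  if-dec-≤ (yes p) x≤y = x≤y p
  if-dec-≤ (no _)  _   = ℤP.≤-refl

  if-dec-≡ : ∀ {P : Set} (p? : Dec P) {x y} → (P → x ≡ y) →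
    (if does p? then x else 0ℤ) ≡ (if does p? then y else 0ℤ)
  if-dec-≡ (yes p) x≡y = x≡y p
  if-dec-≡ (no _)  _   = refl

  if-dec-0 : ∀ {P : Set} (p? : Dec P) {x} → (P → x ≡ 0ℤ) → (if does p? then x else 0ℤ) ≡ 0ℤ
  if-dec-0 (yes p) x≡0 = x≡0 p
  if-dec-0 (no _)  _   = refl

module _ {n : ℕ} (i : ℕ) {f g : Subset n → ℤ} where

  sizeSum-mono : (∀ Y → ∣ Y ∣ ≡ i → f Y ≤ g Y) → sizeSum n i f ≤ sizeSum n i g
  sizeSum-mono f≤g = sumOver-mono (allSubsets n) λ Y → if-dec-≤ (∣ Y ∣ ≟ℕ i) (f≤g Y)

  sizeSum-cong : (∀ Y → ∣ Y ∣ ≡ i → f Y ≡ g Y) → sizeSum n i f ≡ sizeSum n i g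
  sizeSum-cong f≡g = sumOver-cong (allSubsets n) λ Y → if-dec-≡ (∣ Y ∣ ≟ℕ i) (f≡g Y)

  sizeSum-+ : sizeSum n i (λ Y → f Y + g Y) ≡ sizeSum n i f + sizeSum n i g
  sizeSum-+ = trans (sumOver-cong (allSubsets n) pointwise) (sumOver-+ (allSubsets n) _ _)
    where
    pointwise : ∀ Y → (if does (∣ Y ∣ ≟ℕ i) then f Y + g Y else 0ℤ) ≡
                      (if does (∣ Y ∣ ≟ℕ i) then f Y else 0ℤ) + (if does (∣ Y ∣ ≟ℕ i) then g Y else 0ℤ)
    pointwise Y with does (∣ Y ∣ ≟ℕ i)
    ... | true  = refl
    ... | false = refl

sizeSum-vanish : ∀ {n} i {f : Subset n → ℤ} → (∀ Y → ∣ Y ∣ ≡ i → f Y ≡ 0ℤ) → sizeSum n i f ≡ 0ℤ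
sizeSum-vanish {n} i f≡0 =
  trans (sumOver-cong (allSubsets n) λ Y → if-dec-0 (∣ Y ∣ ≟ℕ i) (f≡0 Y)) (sumOver-0 (allSubsets n))

sizeSum-nonneg : ∀ {n} i {f : Subset n → ℤ} → (∀ Y → ∣ Y ∣ ≡ i → 0ℤ ≤ f Y) → 0ℤ ≤ sizeSum n i f
sizeSum-nonneg {n} i {f} 0≤f =
  subst (_≤ sizeSum n i f) (sizeSum-vanish {n} i {λ _ → 0ℤ} λ _ _ → refl) (sizeSum-mono {n} i 0≤f)

∣insertAt-true∣ : ∀ {n} (Y : Subset n) v → ∣ insertAt Y v true ∣ ≡ suc ∣ Y ∣
∣insertAt-true∣ Y           fz     = refl
∣insertAt-true∣ (true ∷ Y)  (fs v) = cong suc (∣insertAt-true∣ Y v)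
∣insertAt-true∣ (false ∷ Y) (fs v) = ∣insertAt-true∣ Y v

∣insertAt-false∣ : ∀ {n} (Y : Subset n) v → ∣ insertAt Y v false ∣ ≡ ∣ Y ∣
∣insertAt-false∣ Y           fz     = refl
∣insertAt-false∣ (true ∷ Y)  (fs v) = cong suc (∣insertAt-false∣ Y v)
∣insertAt-false∣ (false ∷ Y) (fs v) = ∣insertAt-false∣ Y v

sizeSum-insertAt : ∀ m (v : Fin (suc m)) i g →
  sizeSum (suc m) i g ≡
  sumOver (allSubsets m) (λ Y → if does (suc ∣ Y ∣ ≟ℕ i) then g (insertAt Y v true) else 0ℤ) +
  sizeSum m i (λ Y → g (insertAt Y v false))
sizeSum-insertAt m v i g = trans (sumOver-allSubsets-insertAt m v _)
  (cong₂ _+_ (sumOver-cong (allSubsets m) λ Y → cong (restrict (insertAt Y v true)) (∣insertAt-true∣ Y v))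
             (sumOver-cong (allSubsets m) λ Y → cong (restrict (insertAt Y v false)) (∣insertAt-false∣ Y v)))
  where
  restrict : Subset (suc m) → ℕ → ℤ
  restrict Y k = if does (k ≟ℕ i) then g Y else 0ℤ

sizeSum-insertAt-suc : ∀ m (v : Fin (suc m)) i g →
  sizeSum (suc m) (suc i) g ≡ sizeSum m i (λ Y → g (insertAt Y v true)) + sizeSum m (suc i) (λ Y → g (insertAt Y v false))
sizeSum-insertAt-suc m v i g = sizeSum-insertAt m v (suc i) g

sizeSum-insertAt-zero : ∀ m (v : Fin (suc m)) g → sizeSum (suc m) 0 g ≡ sizeSum m 0 (λ Y → g (insertAt Y v false))
sizeSum-insertAt-zero m v g = trans (sizeSum-insertAt m v 0 g)
  (trans (cong (_+ sizeSum m 0 (λ Y → g (insertAt Y v false))) (sumOver-0 (allSubsets m))) (ℤP.+-identityˡ _))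

sizeSum-empty : ∀ n (f : Subset n → ℤ) → sizeSum n 0 f ≡ f ⊥
sizeSum-empty zero    f = ℤP.+-identityʳ (f [])
sizeSum-empty (suc n) f = trans (sizeSum-insertAt-zero n fz f) (sizeSum-empty n _)

subsetCount : ℕ → ℕ → ℤ
subsetCount m i = sizeSum m i (λ _ → 1ℤ)

subsetCount-nonneg : ∀ m i → 0ℤ ≤ subsetCount m i
subsetCount-nonneg m i = sizeSum-nonneg {m} i {λ _ → 1ℤ} λ _ _ → +≤+ z≤n

subsetCount-pos : ∀ m i → i ℕ.≤ m → 1ℤ ≤ subsetCount m i
subsetCount-pos m       zero    _         = ℤP.≤-reflexive (sym (sizeSum-empty m _))
subsetCount-pos (suc m) (suc i) (s≤s i≤m) = begin
  1ℤ + 0ℤ                                  ≤⟨ ℤP.+-mono-≤ (subsetCount-pos m i i≤m) (subsetCount-nonneg m (suc i)) ⟩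
  subsetCount m i + subsetCount m (suc i)  ≡⟨ sizeSum-insertAt-suc m fz i (λ _ → 1ℤ) ⟨
  subsetCount (suc m) (suc i)              ∎
  where open ℤP.≤-Reasoning

module _ {m : ℕ} (v : Fin (suc m)) (g : Subset (suc m) → ℤ) where

  sizeSum-insertAt-false≤ : ∀ i → (∀ Y → suc ∣ Y ∣ ≡ i → 0ℤ ≤ g (insertAt Y v true)) →
    sizeSum m i (λ Y → g (insertAt Y v false)) ≤ sizeSum (suc m) i g
  sizeSum-insertAt-false≤ zero    _    = ℤP.≤-reflexive (sym (sizeSum-insertAt-zero m v g))
  sizeSum-insertAt-false≤ (suc i) 0≤g = begin
    sizeSum m (suc i) without                             ≡⟨ ℤP.+-identityˡ (sizeSum m (suc i) without) ⟨
    0ℤ + sizeSum m (suc i) without                        ≤⟨ ℤP.+-monoˡ-≤ (sizeSum m (suc i) without)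
                                                               (sizeSum-nonneg {m} i {with′} λ Y → 0≤g Y ∘ cong suc) ⟩
    sizeSum m i with′ + sizeSum m (suc i) without         ≡⟨ sizeSum-insertAt-suc m v i g ⟨
    sizeSum (suc m) (suc i) g                             ∎
    where
    open ℤP.≤-Reasoning
    with′ without : Subset m → ℤ
    with′ Y   = g (insertAt Y v true)
    without Y = g (insertAt Y v false)

  sizeSum-insertAt-true≤ : ∀ i → (∀ Y → ∣ Y ∣ ≡ suc i → 0ℤ ≤ g (insertAt Y v false)) →
    sizeSum m i (λ Y → g (insertAt Y v true)) ≤ sizeSum (suc m) (suc i) g
  sizeSum-insertAt-true≤ i 0≤g = begin
    sizeSum m i with′                                     ≡⟨ ℤP.+-identityʳ (sizeSum m i with′) ⟨
    sizeSum m i with′ + 0ℤ                                ≤⟨ ℤP.+-monoʳ-≤ (sizeSum m i with′)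
                                                               (sizeSum-nonneg {m} (suc i) {without} 0≤g) ⟩
    sizeSum m i with′ + sizeSum m (suc i) without         ≡⟨ sizeSum-insertAt-suc m v i g ⟨
    sizeSum (suc m) (suc i) g                             ∎
    where
    open ℤP.≤-Reasoning
    with′ without : Subset m → ℤ
    with′ Y   = g (insertAt Y v true)
    without Y = g (insertAt Y v false)

∃∉ : ∀ {n} (Y : Subset n) → ∣ Y ∣ ℕ.< n → ∃ λ a → a ∉ Y
∃∉ (true ∷ Y)  (s≤s |Y|<n) = let a , a∉ = ∃∉ Y |Y|<n in fs a , a∉ ∘ drop-there
∃∉ (false ∷ Y) _           = fz , λ ()

+≤+-1 : ∀ {a k} → suc a ℕ.≤ k → + a ≤ + k - 1ℤ
+≤+-1 (s≤s a≤k) = +≤+ a≤k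

-- Deleting a vertex: walks, components and vertex cuts

module _ {n : ℕ} {Y : Subset n} {v : Fin (suc n)} {b : Bool} where

  punchIn∈insertAt⁺ : ∀ {a} → a ∈ Y → punchIn v a ∈ insertAt Y v b
  punchIn∈insertAt⁺ {a} a∈Y = lookup⇒[]= _ _ (trans (insertAt-punchIn Y v b a) ([]=⇒lookup a∈Y))

  punchIn∈insertAt⁻ : ∀ {a} → punchIn v a ∈ insertAt Y v b → a ∈ Y
  punchIn∈insertAt⁻ {a} p = lookup⇒[]= a Y (trans (sym (insertAt-punchIn Y v b a)) ([]=⇒lookup p))

  punchIn∉insertAt⁺ : ∀ {a} → a ∉ Y → punchIn v a ∉ insertAt Y v b
  punchIn∉insertAt⁺ a∉Y = a∉Y ∘ punchIn∈insertAt⁻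

  punchIn∉insertAt⁻ : ∀ {a} → punchIn v a ∉ insertAt Y v b → a ∉ Y
  punchIn∉insertAt⁻ p = p ∘ punchIn∈insertAt⁺

∈insertAt-true : ∀ {n} (Y : Subset n) v → v ∈ insertAt Y v true
∈insertAt-true Y v = lookup⇒[]= v _ (insertAt-lookup Y v true)

∉insertAt-false : ∀ {n} (Y : Subset n) v → v ∉ insertAt Y v false
∉insertAt-false Y v p with trans (sym (insertAt-lookup Y v false)) ([]=⇒lookup p)
... | ()

punchIn-onto : ∀ {n} {v u : Fin (suc n)} → u ≢ v → ∃ λ a → punchIn v a ≡ u
punchIn-onto u≢v = punchOut (u≢v ∘ sym) , punchIn-punchOut _

module _ {n : ℕ} {G : Graph (suc n)} {v : Fin (suc n)} {Y : Subset n} {b : Bool} where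

  liftWalk : ∀ {a c} → Connected (delete G v) Y a c → Connected G (insertAt Y v b) (punchIn v a) (punchIn v c)
  liftWalk ε                    = ε
  liftWalk ((a∉ , c∉ , e) ◅ w) = (punchIn∉insertAt⁺ a∉ , punchIn∉insertAt⁺ c∉ , e) ◅ liftWalk w

  lowerWalkFrom : (∀ {z w} → EdgeAvoiding G (insertAt Y v b) z w → w ≢ v) →
    ∀ {x y} → Connected G (insertAt Y v b) x y → ∀ {a} → x ≡ punchIn v a →
    ∃ λ c → y ≡ punchIn v c × Connected (delete G v) Y a c
  lowerWalkFrom avoids ε                         {a} x≡ = a , x≡ , ε
  lowerWalkFrom avoids (e@(a∉ , z∉ , edge) ◅ w) refl with punchIn-onto (avoids e)
  ... | z , refl with lowerWalkFrom avoids w refl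
  ...   | c , y≡ , w′ = c , y≡ , (punchIn∉insertAt⁻ a∉ , punchIn∉insertAt⁻ z∉ , edge) ◅ w′

  lowerWalk : (∀ {z w} → EdgeAvoiding G (insertAt Y v b) z w → w ≢ v) →
              ∀ {a c} → Connected G (insertAt Y v b) (punchIn v a) (punchIn v c) → Connected (delete G v) Y a c
  lowerWalk avoids {a} {c} walk =
    let c′ , c≡ , walk′ = lowerWalkFrom avoids walk refl
    in subst (Connected (delete G v) Y a) (sym (punchIn-injective v c c′ c≡)) walk′

numComponents-pos : ∀ {n} (G : Graph n) {Y k u} → NumComponents G Y k → u ∉ Y → 1 ℕ.≤ k
numComponents-pos G {k = zero}  (label , _) u∉Y with label _ u∉Y
... | ()
numComponents-pos G {k = suc k} _           _   = s≤s z≤n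

module _ {n : ℕ} (G : Graph (suc n)) (v : Fin (suc n)) {Y : Subset n} where

  numComponents-delete : ∀ {k} → NumComponents G (insertAt Y v true) k → NumComponents (delete G v) Y k
  numComponents-delete {k} (label , onto , label≡⇔walk) = label′ , onto′ , label′≡⇔walk
    where
    v∈ = ∈insertAt-true Y v
    label′ : ∀ a → a ∉ Y → Fin k
    label′ a a∉ = label (punchIn v a) (punchIn∉insertAt⁺ a∉)
    onto′ : ∀ j → ∃ λ a → Σ (a ∉ Y) λ a∉ → label′ a a∉ ≡ j
    onto′ j with onto j
    ... | u , u∉ , lu≡j with punchIn-onto (λ u≡v → u∉ (subst (_∈ _) (sym u≡v) v∈))
    ...   | a , refl = a , punchIn∉insertAt⁻ u∉ , trans (Equivalence.from (label≡⇔walk _ _ _ _) ε) lu≡j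
    avoids : ∀ {z w} → EdgeAvoiding G (insertAt Y v true) z w → w ≢ v
    avoids (_ , w∉ , _) refl = w∉ v∈
    label′≡⇔walk : ∀ a c a∉ c∉ → (label′ a a∉ ≡ label′ c c∉) ⇔ Connected (delete G v) Y a c
    label′≡⇔walk a c a∉ c∉ = mk⇔ (lowerWalk {G = G} {b = true} avoids ∘ Equivalence.to (label≡⇔walk _ _ _ _))
                                 (Equivalence.from (label≡⇔walk _ _ _ _) ∘ liftWalk {G = G})

  -- v is a component of T − Y on its own, so the components of (T − v) − Y, together with
  -- that of v, inject into those of T − Y.
  numComponents-deleteIsolated : Isolated G v → ∀ {k k′} →
    NumComponents G (insertAt Y v false) k → NumComponents (delete G v) Y k′ → suc k′ ℕ.≤ k
  numComponents-deleteIsolated isolated (label , _ , label≡⇔walk) (label′ , onto′ , label′≡⇔walk) =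
    injective⇒≤ {f = embed} embed-injective
    where
    v∉ = ∉insertAt-false Y v
    embed : Fin (suc _) → Fin _
    embed fz     = label v v∉
    embed (fs j) = let a , a∉ , _ = onto′ j in label (punchIn v a) (punchIn∉insertAt⁺ a∉)
    noWalkFromV : ∀ {u} → Connected G (insertAt Y v false) v u → u ≢ v → False
    noWalkFromV ε                 u≢v = u≢v refl
    noWalkFromV ((_ , _ , e) ◅ _) _   = isolated _ e
    avoids : ∀ {z w} → EdgeAvoiding G (insertAt Y v false) z w → w ≢ v
    avoids {z} (_ , _ , e) refl = isolated z (trans (Graph.sym G v z) e)
    vAlone : ∀ j → label v v∉ ≢ embed (fs j)
    vAlone j eq = noWalkFromV (Equivalence.to (label≡⇔walk _ _ _ _) eq) (punchInᵢ≢i v _)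
    embed-injective : ∀ {j j′} → embed j ≡ embed j′ → j ≡ j′
    embed-injective {fz}   {fz}    _  = refl
    embed-injective {fz}   {fs j′} eq = ⊥-elim (vAlone j′ eq)
    embed-injective {fs j} {fz}    eq = ⊥-elim (vAlone j (sym eq))
    embed-injective {fs j} {fs j′} eq =
      let a , a∉ , a↦j = onto′ j ; c , c∉ , c↦j′ = onto′ j′
          walk = lowerWalk {G = G} {b = false} avoids (Equivalence.to (label≡⇔walk _ _ _ _) eq)
      in cong fs (trans (sym a↦j) (trans (Equivalence.from (label′≡⇔walk a c a∉ c∉) walk) c↦j′))

dominating∈cut : ∀ {n} {G : Graph n} {v Y} → Dominating G v → IsVertexCut G Y → v ∈ Y
dominating∈cut {G = G} {v} {Y} dominating (u , w , u∉ , w∉ , ¬walk) with v ∈? Y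
... | yes v∈Y = v∈Y
... | no  v∉Y = ⊥-elim (¬walk (toV u u∉ ◅◅ fromV w w∉))
  where
  fromV : ∀ x → x ∉ Y → Connected G Y v x
  fromV x x∉ with x ≟ v
  ... | yes refl = ε
  ... | no  x≢v  = (v∉Y , x∉ , dominating x x≢v) ◅ ε
  toV : ∀ x → x ∉ Y → Connected G Y x v
  toV x x∉ with x ≟ v
  ... | yes refl = ε
  ... | no  x≢v  = (x∉ , v∉Y , trans (Graph.sym G x v) (dominating x x≢v)) ◅ ε

cut-delete : ∀ {n} {G : Graph (suc n)} {v Y} → IsVertexCut G (insertAt Y v true) → IsVertexCut (delete G v) Y
cut-delete {G = G} {v} {Y} (u , w , u∉ , w∉ , ¬walk)
  with punchIn-onto (≢v u∉) | punchIn-onto (≢v w∉)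
  where
  ≢v : ∀ {x} → x ∉ insertAt Y v true → x ≢ v
  ≢v x∉ refl = x∉ (∈insertAt-true Y v)
... | a , refl | c , refl = a , c , punchIn∉insertAt⁻ u∉ , punchIn∉insertAt⁻ w∉ , ¬walk ∘ liftWalk {G = G}

cut-deleteDominating : ∀ {n} {G : Graph (suc n)} {v Y} → Dominating G v → IsVertexCut G Y →
  ∃ λ Y′ → IsVertexCut (delete G v) Y′ × suc ∣ Y′ ∣ ≡ ∣ Y ∣
cut-deleteDominating {G = G} {v} {Y} dominating cut =
  removeAt Y v , cut-delete {G = G} (subst (IsVertexCut G) (sym Y≡) cut) ,
  trans (sym (∣insertAt-true∣ (removeAt Y v) v)) (cong ∣_∣ Y≡)
  where
  v∈Y = dominating∈cut {G = G} dominating cut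
  Y≡ : insertAt (removeAt Y v) v true ≡ Y
  Y≡ = trans (cong (insertAt (removeAt Y v) v) (sym ([]=⇒lookup v∈Y))) (insertAt-removeAt Y v)

∈insertAt-false⇒≢ : ∀ {n} {Y : Subset n} {v u} → u ∈ insertAt Y v false → u ≢ v
∈insertAt-false⇒≢ {Y = Y} {v} u∈ refl = ∉insertAt-false Y v u∈

∈insertAt⊥⇒≡ : ∀ {n} {v u : Fin (suc n)} → u ∈ insertAt ⊥ v true → u ≡ v
∈insertAt⊥⇒≡ {v = v} {u} u∈ with u ≟ v
... | yes u≡v = u≡v
... | no  u≢v with punchIn-onto u≢v
...   | a , refl = ⊥-elim (∉⊥ (punchIn∈insertAt⁻ u∈))

isClique-⊥ : ∀ {n} (G : Graph n) → IsClique G ⊥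
isClique-⊥ G u _ u∈ = ⊥-elim (∉⊥ u∈)

isClique-singleton : ∀ {n} (G : Graph (suc n)) v → IsClique G (insertAt ⊥ v true)
isClique-singleton G v u w u∈ w∈ u≢w = ⊥-elim (u≢w (trans (∈insertAt⊥⇒≡ u∈) (sym (∈insertAt⊥⇒≡ w∈))))

module _ {n : ℕ} (G : Graph (suc n)) (v : Fin (suc n)) {Y : Subset n} where

  isClique-delete : ∀ {b} → IsClique G (insertAt Y v b) → IsClique (delete G v) Y
  isClique-delete clique a c a∈ c∈ a≢c =
    clique (punchIn v a) (punchIn v c) (punchIn∈insertAt⁺ a∈) (punchIn∈insertAt⁺ c∈) (a≢c ∘ punchIn-injective v a c)

  isClique-insertAt-false : IsClique (delete G v) Y → IsClique G (insertAt Y v false)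
  isClique-insertAt-false clique u w u∈ w∈ u≢w
    with punchIn-onto (∈insertAt-false⇒≢ u∈) | punchIn-onto (∈insertAt-false⇒≢ w∈)
  ... | a , refl | c , refl = clique a c (punchIn∈insertAt⁻ u∈) (punchIn∈insertAt⁻ w∈) (u≢w ∘ cong (punchIn v))

  isClique-insertDominating : Dominating G v → IsClique (delete G v) Y → IsClique G (insertAt Y v true)
  isClique-insertDominating dominating clique u w u∈ w∈ u≢w with u ≟ v | w ≟ v
  ... | yes refl | yes refl = ⊥-elim (u≢w refl)
  ... | yes refl | no  w≢v  = dominating w w≢v
  ... | no  u≢v  | yes refl = trans (Graph.sym G u v) (dominating u u≢v)
  ... | no  u≢v  | no  w≢v  with punchIn-onto u≢v | punchIn-onto w≢v
  ...   | a , refl | c , refl = clique a c (punchIn∈insertAt⁻ u∈) (punchIn∈insertAt⁻ w∈) (u≢w ∘ cong (punchIn v))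

  isClique-insertIsolated : Isolated G v → IsClique G (insertAt Y v true) → Y ≡ ⊥
  isClique-insertIsolated isolated clique = Empty-unique λ (a , a∈) →
    isolated (punchIn v a) (clique v (punchIn v a) (∈insertAt-true Y v) (punchIn∈insertAt⁺ a∈) (punchInᵢ≢i v a ∘ sym))

cliqueIndicator : ∀ {n} → Graph n → Subset n → ℤ
cliqueIndicator G Y = if does (isClique? G Y) then 1ℤ else 0ℤ

numCliques : ∀ {n} → Graph n → ℕ → ℤ
numCliques {n} G j = sizeSum n j (cliqueIndicator G)

cliqueCount≡numCliques : ∀ {n} (G : Graph n) j → + cliqueCount G j ≡ numCliques G j
cliqueCount≡numCliques {n} G j = counted (allSubsets n)
  where
  counted : ∀ Ys → + length (filter (isClique? G) (filter (λ Y → ∣ Y ∣ ≟ℕ j) Ys)) ≡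
                   sumOver Ys (λ Y → if does (∣ Y ∣ ≟ℕ j) then cliqueIndicator G Y else 0ℤ)
  counted []       = refl
  counted (Y ∷ Ys) with does (∣ Y ∣ ≟ℕ j)
  ... | false = trans (counted Ys) (sym (ℤP.+-identityˡ _))
  ... | true  with does (isClique? G Y)
  ...   | true  = cong (λ s → 1ℤ + s) (counted Ys)
  ...   | false = trans (counted Ys) (sym (ℤP.+-identityˡ _))

cliqueIndicator-cong : ∀ {m n} (G : Graph m) (H : Graph n) {X Y} →
  (IsClique G X → IsClique H Y) → (IsClique H Y → IsClique G X) → cliqueIndicator G X ≡ cliqueIndicator H Y
cliqueIndicator-cong G H {X} {Y} to from =
  cong (λ b → if b then 1ℤ else 0ℤ) (does-⇔ (mk⇔ to from) (isClique? G X) (isClique? H Y))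

cliqueIndicator-yes : ∀ {n} (G : Graph n) {Y} → IsClique G Y → cliqueIndicator G Y ≡ 1ℤ
cliqueIndicator-yes G {Y} clique = cong (λ b → if b then 1ℤ else 0ℤ) (dec-true (isClique? G Y) clique)

cliqueIndicator-no : ∀ {n} (G : Graph n) {Y} → ¬ IsClique G Y → cliqueIndicator G Y ≡ 0ℤ
cliqueIndicator-no G {Y} ¬clique = cong (λ b → if b then 1ℤ else 0ℤ) (dec-false (isClique? G Y) ¬clique)

numCliques-empty : ∀ {n} (G : Graph n) → numCliques G 0 ≡ 1ℤ
numCliques-empty {n} G = trans (sizeSum-empty n _) (cliqueIndicator-yes G (isClique-⊥ G))

numCliques-beyond : ∀ {n} {G : Graph n} {d j} → (∀ Y → IsClique G Y → ∣ Y ∣ ℕ.≤ d) → d ℕ.< j →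
  numCliques G j ≡ 0ℤ
numCliques-beyond {n} {G} {d} {j} bounded d<j =
  sizeSum-vanish {n} j λ Y |Y|≡j → cliqueIndicator-no G λ clique →
    ℕP.<-irrefl refl (ℕP.≤-<-trans (bounded Y clique) (subst (d ℕ.<_) (sym |Y|≡j) d<j))

module _ {m : ℕ} (G : Graph (suc m)) (v : Fin (suc m)) where

  private
    H = delete G v
    cliquesThroughV : ℕ → ℤ
    cliquesThroughV j = sizeSum m j (λ Y → cliqueIndicator G (insertAt Y v true))

  numCliques-insertAt : ∀ j → numCliques G (suc j) ≡ cliquesThroughV j + numCliques H (suc j)
  numCliques-insertAt j = trans (sizeSum-insertAt-suc m v j (cliqueIndicator G)) (cong (λ s → cliquesThroughV j + s)
    (sizeSum-cong {m} (suc j) λ Y _ → cliqueIndicator-cong G H (isClique-delete G v) (isClique-insertAt-false G v)))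

  numCliques-dominating : Dominating G v → ∀ j → numCliques G (suc j) ≡ numCliques H j + numCliques H (suc j)
  numCliques-dominating dominating j = trans (numCliques-insertAt j) (cong (_+ numCliques H (suc j))
    (sizeSum-cong {m} j λ Y _ → cliqueIndicator-cong G H (isClique-delete G v) (isClique-insertDominating G v dominating)))

  numCliques-isolated-1 : Isolated G v → numCliques G 1 ≡ 1ℤ + numCliques H 1
  numCliques-isolated-1 isolated = trans (numCliques-insertAt 0)
    (cong (_+ numCliques H 1) (trans (sizeSum-empty m _) (cliqueIndicator-yes G (isClique-singleton G v))))

  numCliques-isolated-2+ : Isolated G v → ∀ j → numCliques G (suc (suc j)) ≡ numCliques H (suc (suc j))
  numCliques-isolated-2+ isolated j = trans (numCliques-insertAt (suc j)) (trans
    (cong (_+ numCliques H (suc (suc j))) (sizeSum-vanish {m} (suc j) λ Y |Y|≡1+j → cliqueIndicator-no G λ clique →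
      ℕP.1+n≢0 (trans (sym |Y|≡1+j) (trans (cong ∣_∣ (isClique-insertIsolated G v isolated clique)) (∣⊥∣≡0 m)))))
    (ℤP.+-identityˡ _))

-- Polynomials in coefficient form

poly : ℕ → (ℕ → ℤ) → ℤ → ℤ
poly D a x = sum1to D (λ j → a j * x ^ pred j)

poly-cong : ∀ D (a c : ℕ → ℤ) x → (∀ j → a (suc j) ≡ c (suc j)) → poly D a x ≡ poly D c x
poly-cong zero    a c x a≡c = refl
poly-cong (suc D) a c x a≡c = cong₂ _+_ (poly-cong D a c x a≡c) (cong (_* x ^ D) (a≡c D))

poly-+ : ∀ D (a c : ℕ → ℤ) x → poly D (λ j → a j + c j) x ≡ poly D a x + poly D c x
poly-+ zero    a c x = refl
poly-+ (suc D) a c x = begin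
  poly D (λ j → a j + c j) x + (a (suc D) + c (suc D)) * x ^ D
    ≡⟨ cong₂ _+_ (poly-+ D a c x) (ℤP.*-distribʳ-+ (x ^ D) (a (suc D)) (c (suc D))) ⟩
  (poly D a x + poly D c x) + (a (suc D) * x ^ D + c (suc D) * x ^ D)
    ≡⟨ interchange (poly D a x) _ _ _ ⟩
  poly (suc D) a x + poly (suc D) c x ∎
  where open ≡-Reasoning

poly-horner : ∀ D (a : ℕ → ℤ) x → poly (suc D) a x ≡ a 1 + x * poly D (λ j → a (suc j)) x
poly-horner zero    a x = constantTerm (a 1) x
  where
  constantTerm : ∀ a₁ x → 0ℤ + a₁ * 1ℤ ≡ a₁ + x * 0ℤ
  constantTerm = solve-∀
poly-horner (suc D) a x = begin
  poly (suc D) a x + a (suc (suc D)) * (x * x ^ D)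
    ≡⟨ cong (_+ a (suc (suc D)) * (x * x ^ D)) (poly-horner D a x) ⟩
  (a 1 + x * poly D (λ j → a (suc j)) x) + a (suc (suc D)) * (x * x ^ D)
    ≡⟨ factor (a 1) x (poly D (λ j → a (suc j)) x) (a (suc (suc D))) (x ^ D) ⟩
  a 1 + x * poly (suc D) (λ j → a (suc j)) x ∎
  where
  open ≡-Reasoning
  factor : ∀ a₁ x p c q → (a₁ + x * p) + c * (x * q) ≡ a₁ + x * (p + c * q)
  factor = solve-∀

poly-extend : ∀ {d D} (a : ℕ → ℤ) x → d ℕ.≤ D → (∀ j → d ℕ.< j → a j ≡ 0ℤ) → poly D a x ≡ poly d a x
poly-extend {d} {zero}  a x z≤n _ = refl
poly-extend {d} {suc D} a x d≤1+D vanish with ℕP.m≤n⇒m<n∨m≡n d≤1+D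
... | inj₂ refl       = refl
... | inj₁ (s≤s d≤D) = begin
  poly D a x + a (suc D) * x ^ D ≡⟨ cong₂ _+_ (poly-extend a x d≤D vanish)
                                              (cong (_* x ^ D) (vanish (suc D) (s≤s d≤D))) ⟩
  poly d a x + 0ℤ * x ^ D        ≡⟨ ℤP.+-identityʳ (poly d a x) ⟩
  poly d a x                     ∎
  where open ≡-Reasoning

-- Taking y = ∣ c ∣ gives ∣ c ∣ = (∣ c ∣ + 1) ∣ r y ∣, which forces c = 0.
constant+multiples≡0 : ∀ c (r : ℕ → ℤ) → (∀ y → c + + suc y * r y ≡ 0ℤ) →
  c ≡ 0ℤ × (∀ y → r y ≡ 0ℤ)
constant+multiples≡0 c r vanish = c≡0 , r≡0
  where
  y = ℤ.∣ c ∣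
  ∣c∣≡ : ℤ.∣ c ∣ ≡ suc y ℕ.* ℤ.∣ r y ∣
  ∣c∣≡ = begin
    ℤ.∣ c ∣                       ≡⟨ cong ℤ.∣_∣ (inverseˡ-unique c (+ suc y * r y) (vanish y)) ⟩
    ℤ.∣ - (+ suc y * r y) ∣       ≡⟨ ℤP.∣-i∣≡∣i∣ (+ suc y * r y) ⟩
    ℤ.∣ + suc y * r y ∣           ≡⟨ ℤP.abs-* (+ suc y) (r y) ⟩
    suc y ℕ.* ℤ.∣ r y ∣           ∎
    where open ≡-Reasoning
  c≡0 : c ≡ 0ℤ
  c≡0 with ℤ.∣ r y ∣ in ∣ry∣≡
  ... | zero  = ℤP.∣i∣≡0⇒i≡0 (trans ∣c∣≡ (trans (cong (suc y ℕ.*_) ∣ry∣≡) (ℕP.*-zeroʳ (suc y))))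
  ... | suc k = ⊥-elim (ℕP.<-irrefl refl (ℕP.≤-trans (ℕP.m≤m*n (suc y) (suc k))
                  (ℕP.≤-reflexive (sym (trans ∣c∣≡ (cong (suc y ℕ.*_) ∣ry∣≡))))))
  r≡0 : ∀ y → r y ≡ 0ℤ
  r≡0 y = ℤP.*-cancelˡ-≡ (+ suc y) (r y) 0ℤ (begin
    + suc y * r y               ≡⟨ ℤP.+-identityˡ _ ⟨
    0ℤ + + suc y * r y          ≡⟨ cong (_+ + suc y * r y) c≡0 ⟨
    c + + suc y * r y           ≡⟨ vanish y ⟩
    0ℤ                          ≡⟨ ℤP.*-zeroʳ (+ suc y) ⟨
    + suc y * 0ℤ                ∎)
    where open ≡-Reasoning

poly-agree-suc : ∀ d (a c : ℕ → ℤ) → (∀ y → poly (suc d) a (+ suc y) ≡ poly (suc d) c (+ suc y)) →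
  a 1 ≡ c 1 × (∀ y → poly d (λ j → a (suc j)) (+ suc y) ≡ poly d (λ j → c (suc j)) (+ suc y))
poly-agree-suc d a c agree =
  let a₁-c₁≡0 , tails≡0 = constant+multiples≡0 (a 1 - c 1) (λ y → A y - C y) differenceVanishes
  in ℤP.i-j≡0⇒i≡j (a 1) (c 1) a₁-c₁≡0 , λ y → ℤP.i-j≡0⇒i≡j (A y) (C y) (tails≡0 y)
  where
  A C : ℕ → ℤ
  A y = poly d (λ j → a (suc j)) (+ suc y)
  C y = poly d (λ j → c (suc j)) (+ suc y)
  rearrange : ∀ a₁ c₁ y A C → (a₁ - c₁) + y * (A - C) ≡ (a₁ + y * A) - (c₁ + y * C)
  rearrange = solve-∀
  differenceVanishes : ∀ y → (a 1 - c 1) + + suc y * (A y - C y) ≡ 0ℤ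
  differenceVanishes y = begin
    (a 1 - c 1) + + suc y * (A y - C y)          ≡⟨ rearrange (a 1) (c 1) (+ suc y) (A y) (C y) ⟩
    (a 1 + + suc y * A y) - (c 1 + + suc y * C y) ≡⟨ cong₂ _-_ (poly-horner d a (+ suc y)) (poly-horner d c (+ suc y)) ⟨
    poly (suc d) a (+ suc y) - poly (suc d) c (+ suc y) ≡⟨ cong (_- poly (suc d) c (+ suc y)) (agree y) ⟩
    poly (suc d) c (+ suc y) - poly (suc d) c (+ suc y) ≡⟨ ℤP.+-inverseʳ (poly (suc d) c (+ suc y)) ⟩
    0ℤ                                           ∎
    where open ≡-Reasoning

poly-unique : ∀ d (a c : ℕ → ℤ) → (∀ y → poly d a (+ suc y) ≡ poly d c (+ suc y)) →
  ∀ j → j ℕ.< d → a (suc j) ≡ c (suc j)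
poly-unique (suc d) a c agree zero    _           = proj₁ (poly-agree-suc d a c agree)
poly-unique (suc d) a c agree (suc j) (s≤s j<d) =
  poly-unique d (λ j → a (suc j)) (λ j → c (suc j)) (proj₂ (poly-agree-suc d a c agree)) j j<d

poly-bumpHead : ∀ D (a c : ℕ → ℤ) e x → a 1 ≡ e + c 1 → (∀ j → a (suc (suc j)) ≡ c (suc (suc j))) →
  poly (suc D) a x ≡ e + poly (suc D) c x
poly-bumpHead D a c e x a₁≡ tail≡ = begin
  poly (suc D) a x                               ≡⟨ poly-horner D a x ⟩
  a 1 + x * poly D (λ j → a (suc j)) x           ≡⟨ cong₂ (λ h t → h + x * t) a₁≡
                                                      (poly-cong D (λ j → a (suc j)) (λ j → c (suc j)) x tail≡) ⟩
  (e + c 1) + x * poly D (λ j → c (suc j)) x     ≡⟨ ℤP.+-assoc e (c 1) _ ⟩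
  e + (c 1 + x * poly D (λ j → c (suc j)) x)     ≡⟨ cong (λ s → e + s) (poly-horner D c x) ⟨
  e + poly (suc D) c x                           ∎
  where open ≡-Reasoning

-- The b-vector of a threshold graph

-- With Q(x) = Σᵢ cᵢ xⁱ⁻¹, an isolated vertex adds 1 to Q and a dominating vertex turns Q into
-- 1 + (x + 1) Q. Index 0 is unused: b-vectors are indexed from 1.
addIsolatedVertex : (ℕ → ℕ) → ℕ → ℕ
addIsolatedVertex b zero          = 0
addIsolatedVertex b (suc zero)    = suc (b 1)
addIsolatedVertex b (suc (suc j)) = b (suc (suc j))

addDominatingVertex : (ℕ → ℕ) → ℕ → ℕ
addDominatingVertex b zero          = 0
addDominatingVertex b (suc zero)    = 1
addDominatingVertex b (suc (suc j)) = b (suc j)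

-- A one-vertex graph is an isolated vertex added to the empty graph, whose b-vector is zero.
thresholdB : ∀ {n} {G : Graph n} → IsThreshold G → ℕ → ℕ
thresholdB (single G)             = addIsolatedVertex (λ _ → 0)
thresholdB (step G v (inj₁ _) t) = addIsolatedVertex (thresholdB t)
thresholdB (step G v (inj₂ _) t) = addDominatingVertex (thresholdB t)

single-isolated : (G : Graph 1) → Isolated G fz
single-isolated G fz adj≡true with trans (sym adj≡true) (irrefl G fz)
... | ()

IsBIdentity : ∀ {n} → Graph n → (ℕ → ℕ) → Set
IsBIdentity {n} G b = ∀ D → n ℕ.≤ D → ∀ x → poly D (+_ ∘ b) (x + 1ℤ) ≡ poly D (numCliques G) x

module _ {m : ℕ} (G : Graph (suc m)) (v : Fin (suc m)) {b : ℕ → ℕ} (identity : IsBIdentity (delete G v) b) where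

  private
    H = delete G v

  bIdentity-isolated : Isolated G v → IsBIdentity G (addIsolatedVertex b)
  bIdentity-isolated isolated (suc D) (s≤s m≤D) x = begin
    poly (suc D) (+_ ∘ addIsolatedVertex b) (x + 1ℤ)
      ≡⟨ poly-bumpHead D (+_ ∘ addIsolatedVertex b) (+_ ∘ b) 1ℤ (x + 1ℤ) refl (λ _ → refl) ⟩
    1ℤ + poly (suc D) (+_ ∘ b) (x + 1ℤ)
      ≡⟨ cong (λ s → 1ℤ + s) (identity (suc D) (ℕP.m≤n⇒m≤1+n m≤D) x) ⟩
    1ℤ + poly (suc D) (numCliques H) x
      ≡⟨ poly-bumpHead D (numCliques G) (numCliques H) 1ℤ x
           (numCliques-isolated-1 G v isolated) (numCliques-isolated-2+ G v isolated) ⟨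
    poly (suc D) (numCliques G) x ∎
    where open ≡-Reasoning

  bIdentity-dominating : Dominating G v → IsBIdentity G (addDominatingVertex b)
  bIdentity-dominating dominating (suc D) (s≤s m≤D) x = begin
    poly (suc D) (+_ ∘ addDominatingVertex b) (x + 1ℤ)
      ≡⟨ poly-horner D (+_ ∘ addDominatingVertex b) (x + 1ℤ) ⟩
    1ℤ + (x + 1ℤ) * poly D (λ j → + addDominatingVertex b (suc j)) (x + 1ℤ)
      ≡⟨ cong (λ s → 1ℤ + (x + 1ℤ) * s)
           (trans (poly-cong D (λ j → + addDominatingVertex b (suc j)) (+_ ∘ b) (x + 1ℤ) λ _ → refl)
                  (identity D m≤D x)) ⟩
    1ℤ + (x + 1ℤ) * P
      ≡⟨ distribute x P ⟩
    (1ℤ + x * P) + P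
      ≡⟨ cong (λ s → 1ℤ + x * P + s) (sym P≡) ⟩
    (1ℤ + x * P) + (numCliques H 1 + x * R)
      ≡⟨ regroup x P (numCliques H 1) R ⟩
    (1ℤ + numCliques H 1) + x * (P + R)
      ≡⟨ cong₂ (λ h t → h + x * t)
           (trans (cong (_+ numCliques H 1) (sym (numCliques-empty H))) (sym (numCliques-dominating G v dominating 0)))
           (trans (sym (poly-+ D (numCliques H) (λ j → numCliques H (suc j)) x))
                  (poly-cong D (λ j → numCliques H j + numCliques H (suc j)) (λ j → numCliques G (suc j)) x
                     λ j → sym (numCliques-dominating G v dominating (suc j)))) ⟩
    numCliques G 1 + x * poly D (λ j → numCliques G (suc j)) x
      ≡⟨ poly-horner D (numCliques G) x ⟨
    poly (suc D) (numCliques G) x ∎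
    where
    open ≡-Reasoning
    P = poly D (numCliques H) x
    R = poly D (λ j → numCliques H (suc j)) x
    P≡ : numCliques H 1 + x * R ≡ P
    P≡ = trans (sym (poly-horner D (numCliques H) x)) (poly-extend (numCliques H) x (ℕP.n≤1+n D)
           λ j D<j → numCliques-beyond {G = H} (λ Y _ → ℕP.≤-trans (∣p∣≤n Y) m≤D) D<j)
    distribute : ∀ x P → 1ℤ + (x + 1ℤ) * P ≡ (1ℤ + x * P) + P
    distribute = solve-∀
    regroup : ∀ x P c r → (1ℤ + x * P) + (c + x * r) ≡ (1ℤ + c) + x * (P + r)
    regroup = solve-∀

bIdentity-empty : (G : Graph 0) → IsBIdentity G (λ _ → 0)
bIdentity-empty G D _ x = trans (poly-extend {D = D} _ (x + 1ℤ) z≤n λ _ _ → refl)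
  (sym (poly-extend {D = D} (numCliques G) x z≤n λ _ → numCliques-beyond {G = G} λ Y _ → ∣p∣≤n Y))

thresholdB-identity : ∀ {n} {G : Graph n} (t : IsThreshold G) → IsBIdentity G (thresholdB t)
thresholdB-identity (single G)                    = bIdentity-isolated G fz (bIdentity-empty (delete G fz)) (single-isolated G)
thresholdB-identity (step G v (inj₁ isolated) t)   = bIdentity-isolated G v (thresholdB-identity t) isolated
thresholdB-identity (step G v (inj₂ dominating) t) = bIdentity-dominating G v (thresholdB-identity t) dominating

singletonClique : ∀ {n} (G : Graph (suc n)) v → ∃ λ Y → IsClique G Y × ∣ Y ∣ ≡ 1
singletonClique {n} G v =
  insertAt ⊥ v true , isClique-singleton G v , trans (∣insertAt-true∣ ⊥ v) (cong suc (∣⊥∣≡0 n))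

thresholdB-clique : ∀ {n} {G : Graph n} (t : IsThreshold G) j → 0 ℕ.< thresholdB t j →
  ∃ λ Y → IsClique G Y × ∣ Y ∣ ≡ j
thresholdB-clique (single G)                    1             _ = singletonClique G fz
thresholdB-clique (step G v (inj₁ _) t)          1             _ = singletonClique G v
thresholdB-clique (step G v (inj₂ _) t)          1             _ = singletonClique G v
thresholdB-clique (step G v (inj₁ _) t)          (suc (suc j)) pos
  with Y , clique , |Y|≡ ← thresholdB-clique t (suc (suc j)) pos =
  insertAt Y v false , isClique-insertAt-false G v clique , trans (∣insertAt-false∣ Y v) |Y|≡
thresholdB-clique (step G v (inj₂ dominating) t) (suc (suc j)) pos
  with Y , clique , |Y|≡ ← thresholdB-clique t (suc j) pos =
  insertAt Y v true , isClique-insertDominating G v dominating clique , trans (∣insertAt-true∣ Y v) (cong suc |Y|≡)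

componentSum : ∀ {n} → (Subset n → ℕ) → ℕ → ℤ
componentSum {n} W i = sizeSum n i (λ Y → + W Y)

excessSum : ∀ {n} → (Subset n → ℕ) → ℕ → ℤ
excessSum {n} W i = sizeSum n i (λ Y → + W Y - 1ℤ)

afterDeleting : ∀ {m} → Fin (suc m) → (Subset (suc m) → ℕ) → Subset m → ℕ
afterDeleting v W Y = W (insertAt Y v true)

module _ {m : ℕ} (G : Graph (suc m)) {W : Subset (suc m) → ℕ} (components : ∀ Y → NumComponents G Y (W Y)) where

  componentSum-0 : 1ℤ ≤ componentSum W 0
  componentSum-0 =
    subst (1ℤ ≤_) (sym (sizeSum-empty (suc m) _)) (+≤+ (numComponents-pos G (components ⊥) (∉⊥ {x = fz})))

  module _ (v : Fin (suc m)) where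

    components-delete : ∀ Y → NumComponents (delete G v) Y (afterDeleting v W Y)
    components-delete Y = numComponents-delete G v (components (insertAt Y v true))

    private
      W⁻ = afterDeleting v W
      W-outside-pos : ∀ Y → 1 ℕ.≤ W (insertAt Y v false)
      W-outside-pos Y = numComponents-pos G (components (insertAt Y v false)) (∉insertAt-false Y v)
      W-outside-isolated : Isolated G v → ∀ Y → suc (W⁻ Y) ℕ.≤ W (insertAt Y v false)
      W-outside-isolated isolated Y =
        numComponents-deleteIsolated G v isolated (components (insertAt Y v false)) (components-delete Y)

    componentSum-isolated : Isolated G v → ∀ i → subsetCount m i + componentSum W⁻ i ≤ componentSum W i
    componentSum-isolated isolated i = begin
      subsetCount m i + componentSum W⁻ i              ≡⟨ sizeSum-+ {m} i ⟨
      sizeSum m i (λ Y → + suc (W⁻ Y))                 ≤⟨ sizeSum-mono {m} i (λ Y _ → +≤+ (W-outside-isolated isolated Y)) ⟩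
      sizeSum m i (λ Y → + W (insertAt Y v false))     ≤⟨ sizeSum-insertAt-false≤ v (λ Y → + W Y) i (λ _ _ → +≤+ z≤n) ⟩
      componentSum W i                                 ∎
      where open ℤP.≤-Reasoning

    componentSum-suc : ∀ i → subsetCount m (suc i) + componentSum W⁻ i ≤ componentSum W (suc i)
    componentSum-suc i = begin
      subsetCount m (suc i) + componentSum W⁻ i
        ≤⟨ ℤP.+-monoˡ-≤ (componentSum W⁻ i) (sizeSum-mono {m} (suc i) λ Y _ → +≤+ (W-outside-pos Y)) ⟩
      sizeSum m (suc i) (λ Y → + W (insertAt Y v false)) + componentSum W⁻ i
        ≡⟨ ℤP.+-comm _ (componentSum W⁻ i) ⟩
      componentSum W⁻ i + sizeSum m (suc i) (λ Y → + W (insertAt Y v false))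
        ≡⟨ sizeSum-insertAt-suc m v i (λ Y → + W Y) ⟨
      componentSum W (suc i) ∎
      where open ℤP.≤-Reasoning

    excessSum-suc : ∀ i → excessSum W⁻ i ≤ excessSum W (suc i)
    excessSum-suc i = sizeSum-insertAt-true≤ v (λ Y → + W Y - 1ℤ) i λ Y _ → +≤+-1 (W-outside-pos Y)

    excessSum-isolated : Isolated G v → ∀ i → i ℕ.≤ m → componentSum W⁻ i ≤ excessSum W i
    excessSum-isolated isolated i i≤m = begin
      componentSum W⁻ i
        ≤⟨ sizeSum-mono {m} i (λ Y _ → +≤+-1 (W-outside-isolated isolated Y)) ⟩
      sizeSum m i (λ Y → + W (insertAt Y v false) - 1ℤ)
        ≤⟨ sizeSum-insertAt-false≤ v (λ Y → + W Y - 1ℤ) i W-inside-pos ⟩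
      excessSum W i ∎
      where
      open ℤP.≤-Reasoning
      W-inside-pos : ∀ Y → suc ∣ Y ∣ ≡ i → 0ℤ ≤ + W (insertAt Y v true) - 1ℤ
      W-inside-pos Y 1+|Y|≡i =
        let |Y+v|≤m = subst (ℕ._≤ m) (sym (trans (∣insertAt-true∣ Y v) 1+|Y|≡i)) i≤m
            a , a∉ = ∃∉ (insertAt Y v true) (s≤s |Y+v|≤m)
        in +≤+-1 (numComponents-pos G (components (insertAt Y v true)) a∉)

-- The b-vector bounds the component counts

private
  nonneg+ : ∀ {x y z} → 0ℤ ≤ z → x ≤ y → x ≤ z + y
  nonneg+ {x} {y} {z} 0≤z x≤y = subst (_≤ z + y) (ℤP.+-identityˡ x) (ℤP.+-mono-≤ 0≤z x≤y)

BoundedByComponents : ∀ {n} → (Subset n → ℕ) → (ℕ → ℕ) → Set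
BoundedByComponents W b = ∀ i → + b (suc i) ≤ componentSum W i

module _ {m : ℕ} (G : Graph (suc m)) {W : Subset (suc m) → ℕ} (components : ∀ Y → NumComponents G Y (W Y))
         (v : Fin (suc m)) {b : ℕ → ℕ} (bounded : BoundedByComponents (afterDeleting v W) b) where

  bounded-isolated : Isolated G v → BoundedByComponents W (addIsolatedVertex b)
  bounded-isolated isolated zero    = ℤP.≤-trans (ℤP.+-mono-≤ (subsetCount-pos m 0 z≤n) (bounded 0))
                                                 (componentSum-isolated G components v isolated 0)
  bounded-isolated isolated (suc i) = ℤP.≤-trans (nonneg+ (subsetCount-nonneg m (suc i)) (bounded (suc i)))
                                                 (componentSum-isolated G components v isolated (suc i))

  bounded-dominating : BoundedByComponents W (addDominatingVertex b)
  bounded-dominating zero    = componentSum-0 G components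
  bounded-dominating (suc i) = ℤP.≤-trans (nonneg+ (subsetCount-nonneg m (suc i)) (bounded i))
                                          (componentSum-suc G components v i)

thresholdB≤componentSum : ∀ {n} {G : Graph n} (t : IsThreshold G) {W} → (∀ Y → NumComponents G Y (W Y)) →
  BoundedByComponents W (thresholdB t)
thresholdB≤componentSum (single G) {W} components =
  bounded-isolated G components fz nonneg (single-isolated G)
  where
  nonneg : BoundedByComponents (afterDeleting fz W) (λ _ → 0)
  nonneg i = sizeSum-nonneg {0} i {λ Y → + afterDeleting fz W Y} λ _ _ → +≤+ z≤n
thresholdB≤componentSum (step G v (inj₁ isolated) t) components =
  bounded-isolated G components v (thresholdB≤componentSum t (components-delete G components v)) isolated
thresholdB≤componentSum (step G v (inj₂ dominating) t) components =
  bounded-dominating G components v (thresholdB≤componentSum t (components-delete G components v))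

thresholdB<componentSum : ∀ {n} {G : Graph n} (t : IsThreshold G) {W} → (∀ Y → NumComponents G Y (W Y)) →
  ∀ i → 1 ℕ.≤ i → i ℕ.< n → + suc (thresholdB t (suc i)) ≤ componentSum W i
thresholdB<componentSum {suc m} (step G v (inj₁ isolated) t) components (suc i) _ (s≤s i<m) =
  ℤP.≤-trans (ℤP.+-mono-≤ (subsetCount-pos m (suc i) i<m)
                          (thresholdB≤componentSum t (components-delete G components v) (suc i)))
             (componentSum-isolated G components v isolated (suc i))
thresholdB<componentSum {suc m} (step G v (inj₂ dominating) t) components (suc i) _ (s≤s i<m) =
  ℤP.≤-trans (ℤP.+-mono-≤ (subsetCount-pos m (suc i) i<m)
                          (thresholdB≤componentSum t (components-delete G components v) i))
             (componentSum-suc G components v i)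

thresholdB<excessSum : ∀ {n} {G : Graph n} (t : IsThreshold G) {W} → (∀ Y → NumComponents G Y (W Y)) →
  ∀ {Y} → IsVertexCut G Y → ∀ i → ∣ Y ∣ ℕ.< i → suc (suc i) ℕ.≤ n →
  + suc (thresholdB t (suc i)) ≤ excessSum W i
thresholdB<excessSum (single G) _ (fz , fz , _ , _ , ¬walk) = ⊥-elim (¬walk ε)
thresholdB<excessSum {suc m} (step G v (inj₁ isolated) t) components cut (suc i) _ (s≤s i<m) =
  ℤP.≤-trans (thresholdB<componentSum t (components-delete G components v) (suc i) (s≤s z≤n) i<m)
             (excessSum-isolated G components v isolated (suc i) (ℕP.<⇒≤ i<m))
thresholdB<excessSum {suc m} (step G v (inj₂ dominating) t) components cut i |Y|<i (s≤s 1+i≤m)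
  with Y′ , cut′ , 1+|Y′|≡|Y| ← cut-deleteDominating {G = G} dominating cut
  with suc i′ ← i | s≤s |Y′|<i′ ← subst (ℕ._< i) (sym 1+|Y′|≡|Y|) |Y|<i =
  ℤP.≤-trans (thresholdB<excessSum t (components-delete G components v) cut′ i′ |Y′|<i′ 1+i≤m)
             (excessSum-suc G components v i′)

cliqueNumber≤n : ∀ {n} (G : Graph n) {d} → IsCliqueNumber G d → d ℕ.≤ n
cliqueNumber≤n {n} G ((Y , _ , |Y|≡d) , _) = subst (ℕ._≤ n) |Y|≡d (∣p∣≤n Y)

cliqueNumber<n : ∀ {n} (G : Graph n) {d} → ¬ IsComplete G → IsCliqueNumber G d → d ℕ.< n
cliqueNumber<n G ¬complete ω@((Y , clique , |Y|≡d) , _) = ℕP.≤∧≢⇒< (cliqueNumber≤n G ω) λ d≡n →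
  let Y≡⊤ = ∣p∣≡n⇒p≡⊤ (trans |Y|≡d d≡n)
  in ¬complete λ u w → clique u w (subst (u ∈_) (sym Y≡⊤) ∈⊤) (subst (w ∈_) (sym Y≡⊤) ∈⊤)

thresholdB-beyond : ∀ {n} {G : Graph n} (t : IsThreshold G) {d} → IsCliqueNumber G d →
  ∀ j → d ℕ.< j → thresholdB t j ≡ 0
thresholdB-beyond t (_ , bounded) j d<j with thresholdB t j in tb≡
... | zero  = refl
... | suc _ with Y , clique , |Y|≡j ← thresholdB-clique t j (subst (0 ℕ.<_) (sym tb≡) (s≤s z≤n)) =
  ⊥-elim (ℕP.<-irrefl refl (ℕP.<-≤-trans d<j (subst (ℕ._≤ _) |Y|≡j (bounded Y clique))))

bVector≡thresholdB : ∀ {n} {G : Graph n} (t : IsThreshold G) {d b} → IsCliqueNumber G d → IsBVector G d b →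
  ∀ j → j ℕ.< d → b (suc j) ≡ + thresholdB t (suc j)
bVector≡thresholdB {n} {G} t {d} {b} ω@(_ , bounded) isB = poly-unique d b (+_ ∘ thresholdB t) λ y →
  subst (λ z → poly d b z ≡ poly d (+_ ∘ thresholdB t) z) (cong +_ (ℕP.+-comm y 1)) (agree (+ y))
  where
  agree : ∀ x → poly d b (x + 1ℤ) ≡ poly d (+_ ∘ thresholdB t) (x + 1ℤ)
  agree x = begin
    poly d b (x + 1ℤ)                            ≡⟨ isB x ⟩
    poly d (λ j → + cliqueCount G j) x           ≡⟨ poly-cong d (λ j → + cliqueCount G j) (numCliques G) x
                                                      (λ j → cliqueCount≡numCliques G (suc j)) ⟩
    poly d (numCliques G) x                      ≡⟨ poly-extend (numCliques G) x (cliqueNumber≤n G ω)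
                                                      (λ j → numCliques-beyond {G = G} bounded) ⟨
    poly n (numCliques G) x                      ≡⟨ thresholdB-identity t n ℕP.≤-refl x ⟨
    poly n (+_ ∘ thresholdB t) (x + 1ℤ)          ≡⟨ poly-extend (+_ ∘ thresholdB t) (x + 1ℤ) (cliqueNumber≤n G ω)
                                                      (λ j d<j → cong +_ (thresholdB-beyond t ω j d<j)) ⟩
    poly d (+_ ∘ thresholdB t) (x + 1ℤ)          ∎
    where open ≡-Reasoning

proposition3p4 : ∀ {n} (T : Graph n) → IsThreshold T → ¬ IsComplete T →
    (κ d : ℕ) → IsVertexConnectivity T κ → IsCliqueNumber T d →
    (b : ℕ → ℤ) → IsBVector T d b →
    (W : Subset n → ℕ) → (∀ Y → NumComponents T Y (W Y)) →
    ∀ i → suc κ ℕ.≤ i → suc i ℕ.≤ d →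
    b (suc i) < sumOverSize n i (λ Y → + W Y - 1ℤ)
proposition3p4 {n} T threshold ¬complete κ d ((Y , cut , |Y|≡κ) , _) ω b isB W components i κ<i i<d =
  begin-strict
    b (suc i)                                ≡⟨ bVector≡thresholdB threshold {b = b} ω isB i i<d ⟩
    + thresholdB threshold (suc i)           <⟨ ℤ.+<+ (ℕP.n<1+n (thresholdB threshold (suc i))) ⟩
    + suc (thresholdB threshold (suc i))     ≤⟨ thresholdB<excessSum threshold components cut i |Y|<i 2+i≤n ⟩
    excessSum W i                            ≡⟨ sumOverSize≡sizeSum n i _ ⟨
    sumOverSize n i (λ Y → + W Y - 1ℤ)       ∎
  where
  open ℤP.≤-Reasoning
  |Y|<i = subst (ℕ._< i) (sym |Y|≡κ) κ<i
  2+i≤n = ℕP.≤-trans (s≤s i<d) (cliqueNumber<n T ¬complete ω)
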